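{- Let $\mathcal{C}$ be a category with binary products, let $\Sigma\colon\mathcal{C}\to\mathcal{C}$ be an endofunctor with an initial algebra $(\mu\Sigma,\iota)$ and free algebras $\Sigma^{\star}X$ on every object $X$, and let $B\colon\mathcal{C}\to\mathcal{C}$ be an endofunctor with a final coalgebra $(\nu B,\tau)$. Let $\rho$ be a pre-GSOS law of $\Sigma$ over $B$ that is natural with respect to the morphisms $\hat\iota\colon\Sigma^{\star}(\mu\Sigma)\to\mu\Sigma$ and $\Sigma^{\star}\mathsf{beh}\colon\Sigma^{\star}(\mu\Sigma)\to\Sigma^{\star}(\nu B)$. Then the behaviour morphism $\mathsf{beh}\colon\mu\Sigma\to\nu B$ is a morphic congruence on the initial algebra $(\mu\Sigma,\iota)$.
   Context: Free algebras: $(\Sigma^{\star}X,\iota_X)$ with universal map $\eta_X\colon X\to\Sigma^{\star}X$; they form the free monad $\Sigma^{\star}$ (multiplication $\mu$). $\hat\iota\colon\Sigma^{\star}(\mu\Sigma)\to\mu\Sigma$ is the unique $\Sigma$-algebra morphism $(\Sigma^{\star}(\mu\Sigma),\iota_{\mu\Sigma})\to(\mu\Sigma,\iota)$ with $\hat\iota\circ\eta_{\mu\Sigma}=\mathrm{id}$. A pre-GSOS law of $\Sigma$ over $B$ is a family of morphisms $\rho_X\colon\Sigma(X\times BX)\to B\Sigma^{\star}X$ ($X\in\mathcal{C}$), not required to be natural; it is natural with respect to $f\colon X\to Y$ if $\rho_Y\circ\Sigma(f\times Bf)=B\Sigma^{\star}f\circ\rho_X$. The operational model of $\rho$ is the unique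 $\gamma\colon\mu\Sigma\to B(\mu\Sigma)$ with $\gamma\circ\iota=B\hat\iota\circ\rho_{\mu\Sigma}\circ\Sigma\langle\mathrm{id},\gamma\rangle$, and $\mathsf{beh}\colon(\mu\Sigma,\gamma)\to(\nu B,\tau)$ is the unique $B$-coalgebra morphism into the final coalgebra. A morphism $h\colon A\to A'$ is a morphic congruence on a $\Sigma$-algebra $(A,a)$ if there exists a $\Sigma$-algebra structure $a'\colon\Sigma A'\to A'$ with $h\circ a=a'\circ\Sigma h$. -}

module Defs where

open import Level using (Level; _⊔_; suc)
open import Data.Product using (∃; _,_)
open import Relation.Binary using (IsEquivalence)

record Category (o ℓ e : Level) : Set (suc (o ⊔ ℓ ⊔ e)) where
  infix  4 _≈_
  infixr 9 _∘_
  field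
    Obj : Set o
    Hom : Obj → Obj → Set ℓ
    _≈_ : ∀ {A B} → Hom A B → Hom A B → Set e
    id  : ∀ {A} → Hom A A
    _∘_ : ∀ {A B C} → Hom B C → Hom A B → Hom A C
    equiv     : ∀ {A B} → IsEquivalence (_≈_ {A} {B})
    ∘-resp-≈  : ∀ {A B C} {f h : Hom B C} {g i : Hom A B} →
                f ≈ h → g ≈ i → f ∘ g ≈ h ∘ i
    assoc     : ∀ {A B C D} {f : Hom A B} {g : Hom B C} {h : Hom C D} →
                (h ∘ g) ∘ f ≈ h ∘ (g ∘ f)
    identityˡ : ∀ {A B} {f : Hom A B} → id ∘ f ≈ f
    identityʳ : ∀ {A B} {f : Hom A B} → f ∘ id ≈ f

module _ {o ℓ e : Level} (𝒞 : Category o ℓ e) where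
  open Category 𝒞

  record BinaryProducts : Set (o ⊔ ℓ ⊔ e) where
    field
      _×₀_  : Obj → Obj → Obj
      π₁    : ∀ {A B} → Hom (A ×₀ B) A
      π₂    : ∀ {A B} → Hom (A ×₀ B) B
      ⟨_,_⟩ : ∀ {A B C} → Hom C A → Hom C B → Hom C (A ×₀ B)
      project₁ : ∀ {A B C} {f : Hom C A} {g : Hom C B} → π₁ ∘ ⟨ f , g ⟩ ≈ f
      project₂ : ∀ {A B C} {f : Hom C A} {g : Hom C B} → π₂ ∘ ⟨ f , g ⟩ ≈ g
      unique   : ∀ {A B C} {f : Hom C A} {g : Hom C B} {h : Hom C (A ×₀ B)} →
                 π₁ ∘ h ≈ f → π₂ ∘ h ≈ g → h ≈ ⟨ f , g ⟩

    _×₁_ : ∀ {A B C D} → Hom A C → Hom B D → Hom (A ×₀ B) (C ×₀ D)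
    f ×₁ g = ⟨ f ∘ π₁ , g ∘ π₂ ⟩

  record Endofunctor : Set (o ⊔ ℓ ⊔ e) where
    field
      F₀ : Obj → Obj
      F₁ : ∀ {A B} → Hom A B → Hom (F₀ A) (F₀ B)
      identity     : ∀ {A} → F₁ (id {A}) ≈ id
      homomorphism : ∀ {A B C} {f : Hom A B} {g : Hom B C} →
                     F₁ (g ∘ f) ≈ F₁ g ∘ F₁ f
      F-resp-≈     : ∀ {A B} {f g : Hom A B} → f ≈ g → F₁ f ≈ F₁ g

  module _ (F : Endofunctor) where
    open Endofunctor F

    record Algebra : Set (o ⊔ ℓ) where
      constructor alg
      field
        Carrier   : Obj
        structure : Hom (F₀ Carrier) Carrier

    IsAlgebraMorphism : (X Y : Algebra) →
                        Hom (Algebra.Carrier X) (Algebra.Carrier Y) → Set e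
    IsAlgebraMorphism X Y h =
      h ∘ Algebra.structure X ≈ Algebra.structure Y ∘ F₁ h

    record InitialAlgebra : Set (o ⊔ ℓ ⊔ e) where
      field
        μ : Obj
        ι : Hom (F₀ μ) μ
        fold        : (A : Algebra) → Hom μ (Algebra.Carrier A)
        fold-hom    : (A : Algebra) → IsAlgebraMorphism (alg μ ι) A (fold A)
        fold-unique : (A : Algebra) (h : Hom μ (Algebra.Carrier A)) →
                      IsAlgebraMorphism (alg μ ι) A h → h ≈ fold A

    record FreeAlgebra (X : Obj) : Set (o ⊔ ℓ ⊔ e) where
      field
        T  : Obj
        ιT : Hom (F₀ T) T
        η  : Hom X T
        ext        : (A : Algebra) → Hom X (Algebra.Carrier A) →
                     Hom T (Algebra.Carrier A)
        ext-hom    : (A : Algebra) (f : Hom X (Algebra.Carrier A)) →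
                     IsAlgebraMorphism (alg T ιT) A (ext A f)
        ext-η      : (A : Algebra) (f : Hom X (Algebra.Carrier A)) →
                     ext A f ∘ η ≈ f
        ext-unique : (A : Algebra) (f : Hom X (Algebra.Carrier A))
                     (h : Hom T (Algebra.Carrier A)) →
                     IsAlgebraMorphism (alg T ιT) A h → h ∘ η ≈ f →
                     h ≈ ext A f

    FreeAlgebras : Set (o ⊔ ℓ ⊔ e)
    FreeAlgebras = (X : Obj) → FreeAlgebra X

    module FreeMonad (free : FreeAlgebras) where
      F⋆₀ : Obj → Obj
      F⋆₀ X = FreeAlgebra.T (free X)

      freeAlg : (X : Obj) → Algebra
      freeAlg X = alg (F⋆₀ X) (FreeAlgebra.ιT (free X))

      ηF : (X : Obj) → Hom X (F⋆₀ X)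
      ηF X = FreeAlgebra.η (free X)

      F⋆₁ : ∀ {X Y} → Hom X Y → Hom (F⋆₀ X) (F⋆₀ Y)
      F⋆₁ {X} {Y} f = FreeAlgebra.ext (free X) (freeAlg Y) (ηF Y ∘ f)

    IsCoalgebraMorphism : {X Y : Obj} (c : Hom X (F₀ X)) (d : Hom Y (F₀ Y)) →
                          Hom X Y → Set e
    IsCoalgebraMorphism c d h = d ∘ h ≈ F₁ h ∘ c

    record FinalCoalgebra : Set (o ⊔ ℓ ⊔ e) where
      field
        ν : Obj
        τ : Hom ν (F₀ ν)
        unfold        : ∀ {X} (c : Hom X (F₀ X)) → Hom X ν
        unfold-hom    : ∀ {X} (c : Hom X (F₀ X)) →
                        IsCoalgebraMorphism c τ (unfold c)
        unfold-unique : ∀ {X} (c : Hom X (F₀ X)) (h : Hom X ν) →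
                        IsCoalgebraMorphism c τ h → h ≈ unfold c

  IsMorphicCongruence : (F : Endofunctor) (A : Algebra F) {A' : Obj} →
                        Hom (Algebra.Carrier A) A' → Set (ℓ ⊔ e)
  IsMorphicCongruence F A {A'} h =
    ∃ λ (a' : Hom (Endofunctor.F₀ F A') A') →
      h ∘ Algebra.structure A ≈ a' ∘ Endofunctor.F₁ F h

  module GSOS (P : BinaryProducts) (Sig : Endofunctor) (B : Endofunctor)
              (free : FreeAlgebras Sig) where
    open BinaryProducts P
    open Endofunctor Sig renaming (F₀ to Σ₀; F₁ to Σ₁)
    open Endofunctor B renaming (F₀ to B₀; F₁ to B₁)
    open FreeMonad Sig free public

    -- pre-GSOS law: a family ρ_X, not required to be natural
    PreGSOSLaw : Set (o ⊔ ℓ)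
    PreGSOSLaw = (X : Obj) → Hom (Σ₀ (X ×₀ B₀ X)) (B₀ (F⋆₀ X))

    NaturalWrt : PreGSOSLaw → ∀ {X Y} → Hom X Y → Set e
    NaturalWrt ρ {X} {Y} f =
      ρ Y ∘ Σ₁ (f ×₁ B₁ f) ≈ B₁ (F⋆₁ f) ∘ ρ X

    module _ (I : InitialAlgebra Sig) where
      open InitialAlgebra I

      ι̂ : Hom (F⋆₀ μ) μ
      ι̂ = FreeAlgebra.ext (free μ) (alg μ ι) id

      IsOperationalModel : PreGSOSLaw → Hom μ (B₀ μ) → Set e
      IsOperationalModel ρ γ = γ ∘ ι ≈ B₁ ι̂ ∘ (ρ μ ∘ Σ₁ ⟨ id , γ ⟩)

{-# OPTIONS --safe #-}
module Submission where

-- A coalgebra β on X extends along ρ to a coalgebra lift β on Σ⋆X: the second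
-- component of the algebra morphism Σ⋆X → Σ⋆X × BΣ⋆X extending ⟨η, Bη ∘ β⟩.
-- Any algebra morphism into A × BA with the matching values on generators has
-- B h ∘ lift β as second component, provided ρ is natural w.r.t. h. Applied to
-- h = Σ⋆beh and h = ι̂ this makes Σ⋆beh : lift γ → lift τ and ι̂ : lift γ → γ
-- coalgebra morphisms, so by finality beh ∘ ι̂ = unfold (lift τ) ∘ Σ⋆beh; and a
-- map h whose composite with the evaluation Σ⋆A → A factors through Σ⋆h is a
-- morphic congruence, with structure the factor restricted to flat terms.

open import Level using (Level)
open import Data.Product using (_,_)
open import Relation.Binary using (Setoid; IsEquivalence)
import Relation.Binary.Reasoning.Setoid as SetoidReasoning
open import Defs

module CategoryReasoning {o ℓ e : Level} (𝒞 : Category o ℓ e) where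
  open Category 𝒞

  hom-setoid : Obj → Obj → Setoid ℓ e
  hom-setoid A B = record { isEquivalence = equiv {A} {B} }

  module _ {A B : Obj} where
    open IsEquivalence (equiv {A} {B}) public
      using () renaming (refl to ≈-refl; sym to ≈-sym; trans to ≈-trans)
    open SetoidReasoning (hom-setoid A B) public

  infixr 4 refl⟩∘⟨_
  infixl 5 _⟩∘⟨refl

  refl⟩∘⟨_ : ∀ {A B C} {f : Hom B C} {g i : Hom A B} → g ≈ i → f ∘ g ≈ f ∘ i
  refl⟩∘⟨ p = ∘-resp-≈ ≈-refl p

  _⟩∘⟨refl : ∀ {A B C} {f h : Hom B C} {g : Hom A B} → f ≈ h → f ∘ g ≈ h ∘ g
  p ⟩∘⟨refl = ∘-resp-≈ p ≈-refl

  sym-assoc : ∀ {A B C D} {f : Hom A B} {g : Hom B C} {h : Hom C D} →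
              h ∘ (g ∘ f) ≈ (h ∘ g) ∘ f
  sym-assoc = ≈-sym assoc

  glue : ∀ {A B C D E F} {g : Hom A B} {w : Hom A C} {h : Hom B D} {u : Hom B E}
           {v : Hom C E} {s : Hom D F} {t : Hom E F} →
         s ∘ h ≈ t ∘ u → u ∘ g ≈ v ∘ w → s ∘ (h ∘ g) ≈ (t ∘ v) ∘ w
  glue {g = g} {w} {h} {u} {v} {s} {t} q p = begin
    s ∘ (h ∘ g)   ≈⟨ sym-assoc ⟩
    (s ∘ h) ∘ g   ≈⟨ q ⟩∘⟨refl ⟩
    (t ∘ u) ∘ g   ≈⟨ assoc ⟩
    t ∘ (u ∘ g)   ≈⟨ refl⟩∘⟨ p ⟩
    t ∘ (v ∘ w)   ≈⟨ sym-assoc ⟩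
    (t ∘ v) ∘ w   ∎

module ProductLemmas {o ℓ e : Level} {𝒞 : Category o ℓ e} (P : BinaryProducts 𝒞) where
  open Category 𝒞
  open CategoryReasoning 𝒞
  open BinaryProducts P

  ⟨⟩-cong : ∀ {A B C} {f f′ : Hom C A} {g g′ : Hom C B} →
            f ≈ f′ → g ≈ g′ → ⟨ f , g ⟩ ≈ ⟨ f′ , g′ ⟩
  ⟨⟩-cong p q = unique (≈-trans project₁ p) (≈-trans project₂ q)

  ⟨⟩∘ : ∀ {A B C D} {f : Hom C A} {g : Hom C B} {h : Hom D C} →
        ⟨ f , g ⟩ ∘ h ≈ ⟨ f ∘ h , g ∘ h ⟩
  ⟨⟩∘ = unique (≈-trans sym-assoc (project₁ ⟩∘⟨refl))
               (≈-trans sym-assoc (project₂ ⟩∘⟨refl))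

  ×₁∘⟨⟩ : ∀ {A B A′ B′ C} {f : Hom A A′} {g : Hom B B′} {a : Hom C A} {b : Hom C B} →
          (f ×₁ g) ∘ ⟨ a , b ⟩ ≈ ⟨ f ∘ a , g ∘ b ⟩
  ×₁∘⟨⟩ = ≈-trans ⟨⟩∘ (⟨⟩-cong (≈-trans assoc (refl⟩∘⟨ project₁))
                                (≈-trans assoc (refl⟩∘⟨ project₂)))

module FunctorLemmas {o ℓ e : Level} {𝒞 : Category o ℓ e} (F : Endofunctor 𝒞) where
  open Category 𝒞
  open CategoryReasoning 𝒞
  open Endofunctor F

  F-resp-square : ∀ {A B C D} {f : Hom A B} {g : Hom B D} {h : Hom A C} {k : Hom C D} →
                  g ∘ f ≈ k ∘ h → F₁ g ∘ F₁ f ≈ F₁ k ∘ F₁ h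
  F-resp-square p = ≈-trans (≈-sym homomorphism) (≈-trans (F-resp-≈ p) homomorphism)

  ∘-isAlgebraMorphism : ∀ {X Y Z : Algebra 𝒞 F} {g h} →
                        IsAlgebraMorphism 𝒞 F X Y g → IsAlgebraMorphism 𝒞 F Y Z h →
                        IsAlgebraMorphism 𝒞 F X Z (h ∘ g)
  ∘-isAlgebraMorphism p q =
    ≈-trans (≈-sym (glue (≈-sym q) (≈-sym p))) (refl⟩∘⟨ ≈-sym homomorphism)

  ∘-isCoalgebraMorphism : ∀ {X Y Z} {c : Hom X (F₀ X)} {d : Hom Y (F₀ Y)} {z : Hom Z (F₀ Z)}
                            {g h} →
                          IsCoalgebraMorphism 𝒞 F c d g → IsCoalgebraMorphism 𝒞 F d z h →
                          IsCoalgebraMorphism 𝒞 F c z (h ∘ g)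
  ∘-isCoalgebraMorphism p q = ≈-trans (glue q p) (≈-sym homomorphism ⟩∘⟨refl)

  unfold-unique₂ : (N : FinalCoalgebra 𝒞 F) → let open FinalCoalgebra N in
                   ∀ {X} (c : Hom X (F₀ X)) {g h : Hom X ν} →
                   IsCoalgebraMorphism 𝒞 F c τ g → IsCoalgebraMorphism 𝒞 F c τ h → g ≈ h
  unfold-unique₂ N c p q = ≈-trans (unfold-unique c _ p) (≈-sym (unfold-unique c _ q))
    where open FinalCoalgebra N

module FreeAlgebraLemmas {o ℓ e : Level} {𝒞 : Category o ℓ e}
                         (Sig : Endofunctor 𝒞) (free : FreeAlgebras 𝒞 Sig) where
  open Category 𝒞
  open CategoryReasoning 𝒞
  open Endofunctor Sig renaming (F₀ to Σ₀; F₁ to Σ₁)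
  open FunctorLemmas Sig
  open FreeMonad 𝒞 Sig free
  open Algebra

  ιF : (X : Obj) → Hom (Σ₀ (F⋆₀ X)) (F⋆₀ X)
  ιF X = structure (freeAlg X)

  ext-unique₂ : ∀ {X} (A : Algebra 𝒞 Sig) {g h : Hom (F⋆₀ X) (Carrier A)} →
                IsAlgebraMorphism 𝒞 Sig (freeAlg X) A g →
                IsAlgebraMorphism 𝒞 Sig (freeAlg X) A h →
                g ∘ ηF X ≈ h ∘ ηF X → g ≈ h
  ext-unique₂ {X} A {g} {h} g-hom h-hom g∘η≈h∘η =
    ≈-trans (ext-unique A (h ∘ ηF X) g g-hom g∘η≈h∘η)
            (≈-sym (ext-unique A (h ∘ ηF X) h h-hom ≈-refl))
    where open FreeAlgebra (free X)

  F⋆₁-isAlgebraMorphism : ∀ {X Y} (f : Hom X Y) →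
                          IsAlgebraMorphism 𝒞 Sig (freeAlg X) (freeAlg Y) (F⋆₁ f)
  F⋆₁-isAlgebraMorphism {X} {Y} f = FreeAlgebra.ext-hom (free X) (freeAlg Y) (ηF Y ∘ f)

  F⋆₁∘η : ∀ {X Y} (f : Hom X Y) → F⋆₁ f ∘ ηF X ≈ ηF Y ∘ f
  F⋆₁∘η {X} {Y} f = FreeAlgebra.ext-η (free X) (freeAlg Y) (ηF Y ∘ f)

  eval : (A : Algebra 𝒞 Sig) → Hom (F⋆₀ (Carrier A)) (Carrier A)
  eval A = FreeAlgebra.ext (free (Carrier A)) A id

  eval-isAlgebraMorphism : (A : Algebra 𝒞 Sig) →
                           IsAlgebraMorphism 𝒞 Sig (freeAlg (Carrier A)) A (eval A)
  eval-isAlgebraMorphism A = FreeAlgebra.ext-hom (free (Carrier A)) A id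

  eval∘η : (A : Algebra 𝒞 Sig) → eval A ∘ ηF (Carrier A) ≈ id
  eval∘η A = FreeAlgebra.ext-η (free (Carrier A)) A id

  join : (X : Obj) → Hom (F⋆₀ (F⋆₀ X)) (F⋆₀ X)
  join X = eval (freeAlg X)

  ∘join≈eval∘F⋆₁ : ∀ {X} {A : Algebra 𝒞 Sig} {g : Hom (F⋆₀ X) (Carrier A)} →
                   IsAlgebraMorphism 𝒞 Sig (freeAlg X) A g →
                   g ∘ join X ≈ eval A ∘ F⋆₁ g
  ∘join≈eval∘F⋆₁ {X} {A} {g} g-hom = ext-unique₂ A
    (∘-isAlgebraMorphism {freeAlg (F⋆₀ X)} {freeAlg X} {A}
      (eval-isAlgebraMorphism (freeAlg X)) g-hom)
    (∘-isAlgebraMorphism {freeAlg (F⋆₀ X)} {freeAlg (Carrier A)} {A}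
      (F⋆₁-isAlgebraMorphism g) (eval-isAlgebraMorphism A))
    (begin
      (g ∘ join X) ∘ ηF (F⋆₀ X)            ≈⟨ assoc ⟩
      g ∘ (join X ∘ ηF (F⋆₀ X))            ≈⟨ refl⟩∘⟨ eval∘η (freeAlg X) ⟩
      g ∘ id                               ≈⟨ identityʳ ⟩
      g                                    ≈⟨ identityˡ ⟨
      id ∘ g                               ≈⟨ eval∘η A ⟩∘⟨refl ⟨
      (eval A ∘ ηF (Carrier A)) ∘ g        ≈⟨ glue ≈-refl (F⋆₁∘η g) ⟨
      eval A ∘ (F⋆₁ g ∘ ηF (F⋆₀ X))        ≈⟨ sym-assoc ⟩
      (eval A ∘ F⋆₁ g) ∘ ηF (F⋆₀ X)        ∎)

  flat : (X : Obj) → Hom (Σ₀ X) (F⋆₀ X)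
  flat X = ιF X ∘ Σ₁ (ηF X)

  ∘flat : ∀ {X} {A : Algebra 𝒞 Sig} {g : Hom (F⋆₀ X) (Carrier A)} →
          IsAlgebraMorphism 𝒞 Sig (freeAlg X) A g →
          g ∘ flat X ≈ structure A ∘ Σ₁ (g ∘ ηF X)
  ∘flat g-hom = ≈-trans (glue g-hom ≈-refl) (≈-trans assoc (refl⟩∘⟨ ≈-sym homomorphism))

  structure≈eval∘flat : (A : Algebra 𝒞 Sig) → structure A ≈ eval A ∘ flat (Carrier A)
  structure≈eval∘flat A = begin
    structure A                                   ≈⟨ identityʳ ⟨
    structure A ∘ id                              ≈⟨ refl⟩∘⟨ identity ⟨
    structure A ∘ Σ₁ id                           ≈⟨ refl⟩∘⟨ F-resp-≈ (eval∘η A) ⟨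
    structure A ∘ Σ₁ (eval A ∘ ηF (Carrier A))    ≈⟨ ∘flat (eval-isAlgebraMorphism A) ⟨
    eval A ∘ flat (Carrier A)                     ∎

  F⋆₁∘flat : ∀ {X Y} (f : Hom X Y) → F⋆₁ f ∘ flat X ≈ flat Y ∘ Σ₁ f
  F⋆₁∘flat {X} {Y} f = begin
    F⋆₁ f ∘ flat X            ≈⟨ ∘flat (F⋆₁-isAlgebraMorphism f) ⟩
    ιF Y ∘ Σ₁ (F⋆₁ f ∘ ηF X)  ≈⟨ refl⟩∘⟨ F-resp-≈ (F⋆₁∘η f) ⟩
    ιF Y ∘ Σ₁ (ηF Y ∘ f)      ≈⟨ refl⟩∘⟨ homomorphism ⟩
    ιF Y ∘ (Σ₁ (ηF Y) ∘ Σ₁ f) ≈⟨ sym-assoc ⟩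
    flat Y ∘ Σ₁ f             ∎

  factorisation⇒isMorphicCongruence :
    (A : Algebra 𝒞 Sig) {A′ : Obj} (h : Hom (Carrier A) A′) (u : Hom (F⋆₀ A′) A′) →
    h ∘ eval A ≈ u ∘ F⋆₁ h → IsMorphicCongruence 𝒞 Sig A h
  factorisation⇒isMorphicCongruence A {A′} h u h∘eval≈u∘F⋆₁h =
    u ∘ flat A′ ,
    ≈-trans (refl⟩∘⟨ structure≈eval∘flat A) (glue h∘eval≈u∘F⋆₁h (F⋆₁∘flat h))

module LiftedCoalgebras {o ℓ e : Level} {𝒞 : Category o ℓ e} (P : BinaryProducts 𝒞)
                        (Sig B : Endofunctor 𝒞) (free : FreeAlgebras 𝒞 Sig)
                        (ρ : GSOS.PreGSOSLaw 𝒞 P Sig B free) where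
  open Category 𝒞
  open CategoryReasoning 𝒞
  open BinaryProducts P
  open ProductLemmas P
  open Endofunctor Sig using ()
    renaming (F₁ to Σ₁; identity to Σ-identity; homomorphism to Σ-homomorphism;
              F-resp-≈ to Σ-resp-≈)
  open Endofunctor B using ()
    renaming (F₀ to B₀; F₁ to B₁; identity to B-identity; homomorphism to B-homomorphism;
              F-resp-≈ to B-resp-≈)
  open FunctorLemmas Sig using (∘-isAlgebraMorphism) renaming (F-resp-square to Σ-resp-square)
  open FunctorLemmas B using () renaming (F-resp-square to B-resp-square)
  open FreeMonad 𝒞 Sig free
  open FreeAlgebraLemmas Sig free
  open GSOS 𝒞 P Sig B free using (NaturalWrt)
  open Algebra

  pairAlgebra : Algebra 𝒞 Sig → Algebra 𝒞 Sig
  pairAlgebra A = alg (Carrier A ×₀ B₀ (Carrier A))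
                      ⟨ structure A ∘ Σ₁ π₁ , B₁ (eval A) ∘ ρ (Carrier A) ⟩

  -- For the initial algebra, eval is ι̂ and IsBialgebra is IsOperationalModel.
  IsBialgebra : (A : Algebra 𝒞 Sig) → Hom (Carrier A) (B₀ (Carrier A)) → Set e
  IsBialgebra A δ = δ ∘ structure A ≈ B₁ (eval A) ∘ (ρ (Carrier A) ∘ Σ₁ ⟨ id , δ ⟩)

  ⟨id,δ⟩-isAlgebraMorphism : ∀ {A δ} → IsBialgebra A δ →
                             IsAlgebraMorphism 𝒞 Sig A (pairAlgebra A) ⟨ id , δ ⟩
  ⟨id,δ⟩-isAlgebraMorphism {A} {δ} bialgebra = begin
    ⟨ id , δ ⟩ ∘ a                                         ≈⟨ ⟨⟩∘ ⟩
    ⟨ id ∘ a , δ ∘ a ⟩                                     ≈⟨ ⟨⟩-cong a≈first (≈-trans bialgebra sym-assoc) ⟩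
    ⟨ (a ∘ Σ₁ π₁) ∘ Σ₁ ⟨ id , δ ⟩ , r ∘ Σ₁ ⟨ id , δ ⟩ ⟩     ≈⟨ ⟨⟩∘ ⟨
    ⟨ a ∘ Σ₁ π₁ , r ⟩ ∘ Σ₁ ⟨ id , δ ⟩                      ∎
    where
    a = structure A
    r = B₁ (eval A) ∘ ρ (Carrier A)
    a≈first : id ∘ a ≈ (a ∘ Σ₁ π₁) ∘ Σ₁ ⟨ id , δ ⟩
    a≈first = begin
      id ∘ a                          ≈⟨ identityˡ ⟩
      a                               ≈⟨ identityʳ ⟨
      a ∘ id                          ≈⟨ refl⟩∘⟨ Σ-identity ⟨
      a ∘ Σ₁ id                       ≈⟨ refl⟩∘⟨ Σ-resp-≈ project₁ ⟨
      a ∘ Σ₁ (π₁ ∘ ⟨ id , δ ⟩)        ≈⟨ refl⟩∘⟨ Σ-homomorphism ⟩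
      a ∘ (Σ₁ π₁ ∘ Σ₁ ⟨ id , δ ⟩)     ≈⟨ sym-assoc ⟩
      (a ∘ Σ₁ π₁) ∘ Σ₁ ⟨ id , δ ⟩     ∎

  ×₁B₁-isAlgebraMorphism : ∀ {X} {A : Algebra 𝒞 Sig} {h : Hom (F⋆₀ X) (Carrier A)} →
    IsAlgebraMorphism 𝒞 Sig (freeAlg X) A h → NaturalWrt ρ h →
    IsAlgebraMorphism 𝒞 Sig (pairAlgebra (freeAlg X)) (pairAlgebra A) (h ×₁ B₁ h)
  ×₁B₁-isAlgebraMorphism {X} {A} {h} h-hom h-natural = begin
    (h ×₁ B₁ h) ∘ ⟨ ιF X ∘ Σ₁ π₁ , B₁ (join X) ∘ ρ (F⋆₀ X) ⟩  ≈⟨ ×₁∘⟨⟩ ⟩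
    ⟨ h ∘ (ιF X ∘ Σ₁ π₁) , B₁ h ∘ (B₁ (join X) ∘ ρ (F⋆₀ X)) ⟩ ≈⟨ ⟨⟩-cong
      (glue h-hom (Σ-resp-square (≈-sym project₁)))
      (glue (B-resp-square (∘join≈eval∘F⋆₁ h-hom)) (≈-sym h-natural)) ⟩
    ⟨ (a ∘ Σ₁ π₁) ∘ Σ₁ (h ×₁ B₁ h) , r ∘ Σ₁ (h ×₁ B₁ h) ⟩     ≈⟨ ⟨⟩∘ ⟨
    ⟨ a ∘ Σ₁ π₁ , r ⟩ ∘ Σ₁ (h ×₁ B₁ h)                        ∎
    where
    a = structure A
    r = B₁ (eval A) ∘ ρ (Carrier A)

  liftPair : ∀ {X} → Hom X (B₀ X) → Hom (F⋆₀ X) (F⋆₀ X ×₀ B₀ (F⋆₀ X))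
  liftPair {X} β = FreeAlgebra.ext (free X) (pairAlgebra (freeAlg X)) ⟨ ηF X , B₁ (ηF X) ∘ β ⟩

  liftPair-isAlgebraMorphism : ∀ {X} (β : Hom X (B₀ X)) →
    IsAlgebraMorphism 𝒞 Sig (freeAlg X) (pairAlgebra (freeAlg X)) (liftPair β)
  liftPair-isAlgebraMorphism {X} β =
    FreeAlgebra.ext-hom (free X) (pairAlgebra (freeAlg X)) ⟨ ηF X , B₁ (ηF X) ∘ β ⟩

  liftPair∘η : ∀ {X} (β : Hom X (B₀ X)) → liftPair β ∘ ηF X ≈ ⟨ ηF X , B₁ (ηF X) ∘ β ⟩
  liftPair∘η {X} β = FreeAlgebra.ext-η (free X) (pairAlgebra (freeAlg X)) ⟨ ηF X , B₁ (ηF X) ∘ β ⟩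

  lift : ∀ {X} → Hom X (B₀ X) → Hom (F⋆₀ X) (B₀ (F⋆₀ X))
  lift β = π₂ ∘ liftPair β

  π₂∘≈B₁∘lift : ∀ {X} {β : Hom X (B₀ X)} {A : Algebra 𝒞 Sig} {h : Hom (F⋆₀ X) (Carrier A)}
                  {φ : Hom (F⋆₀ X) (Carrier A ×₀ B₀ (Carrier A))} →
                IsAlgebraMorphism 𝒞 Sig (freeAlg X) A h → NaturalWrt ρ h →
                IsAlgebraMorphism 𝒞 Sig (freeAlg X) (pairAlgebra A) φ →
                φ ∘ ηF X ≈ ⟨ h ∘ ηF X , B₁ (h ∘ ηF X) ∘ β ⟩ →
                π₂ ∘ φ ≈ B₁ h ∘ lift β
  π₂∘≈B₁∘lift {X} {β} {A} {h} {φ} h-hom h-natural φ-hom φ∘η = begin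
    π₂ ∘ φ                           ≈⟨ refl⟩∘⟨ φ≈ ⟩
    π₂ ∘ ((h ×₁ B₁ h) ∘ liftPair β)  ≈⟨ glue project₂ ≈-refl ⟩
    (B₁ h ∘ π₂) ∘ liftPair β         ≈⟨ assoc ⟩
    B₁ h ∘ lift β                    ∎
    where
    φ≈ : φ ≈ (h ×₁ B₁ h) ∘ liftPair β
    φ≈ = ext-unique₂ (pairAlgebra A) φ-hom
      (∘-isAlgebraMorphism {freeAlg X} {pairAlgebra (freeAlg X)} {pairAlgebra A}
        (liftPair-isAlgebraMorphism β) (×₁B₁-isAlgebraMorphism h-hom h-natural))
      (begin
        φ ∘ ηF X                                    ≈⟨ φ∘η ⟩
        ⟨ h ∘ ηF X , B₁ (h ∘ ηF X) ∘ β ⟩            ≈⟨ ⟨⟩-cong ≈-refl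
                                                       (≈-trans (B-homomorphism ⟩∘⟨refl) assoc) ⟩
        ⟨ h ∘ ηF X , B₁ h ∘ (B₁ (ηF X) ∘ β) ⟩       ≈⟨ ×₁∘⟨⟩ ⟨
        (h ×₁ B₁ h) ∘ ⟨ ηF X , B₁ (ηF X) ∘ β ⟩      ≈⟨ refl⟩∘⟨ liftPair∘η β ⟨
        (h ×₁ B₁ h) ∘ (liftPair β ∘ ηF X)           ≈⟨ sym-assoc ⟩
        ((h ×₁ B₁ h) ∘ liftPair β) ∘ ηF X           ∎)

  F⋆₁-isCoalgebraMorphism : ∀ {X Y} {β : Hom X (B₀ X)} {δ : Hom Y (B₀ Y)} {f : Hom X Y} →
                            IsCoalgebraMorphism 𝒞 B β δ f → NaturalWrt ρ (F⋆₁ f) →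
                            IsCoalgebraMorphism 𝒞 B (lift β) (lift δ) (F⋆₁ f)
  F⋆₁-isCoalgebraMorphism {X} {Y} {β} {δ} {f} f-hom f-natural =
    ≈-trans assoc (π₂∘≈B₁∘lift (F⋆₁-isAlgebraMorphism f) f-natural
      (∘-isAlgebraMorphism {freeAlg X} {freeAlg Y} {pairAlgebra (freeAlg Y)}
        (F⋆₁-isAlgebraMorphism f) (liftPair-isAlgebraMorphism δ))
      (begin
        (liftPair δ ∘ F⋆₁ f) ∘ ηF X                 ≈⟨ assoc ⟩
        liftPair δ ∘ (F⋆₁ f ∘ ηF X)                 ≈⟨ glue ≈-refl (F⋆₁∘η f) ⟩
        (liftPair δ ∘ ηF Y) ∘ f                     ≈⟨ liftPair∘η δ ⟩∘⟨refl ⟩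
        ⟨ ηF Y , B₁ (ηF Y) ∘ δ ⟩ ∘ f                ≈⟨ ⟨⟩∘ ⟩
        ⟨ ηF Y ∘ f , (B₁ (ηF Y) ∘ δ) ∘ f ⟩          ≈⟨ ⟨⟩-cong (≈-sym (F⋆₁∘η f)) generators ⟩
        ⟨ F⋆₁ f ∘ ηF X , B₁ (F⋆₁ f ∘ ηF X) ∘ β ⟩    ∎))
    where
    generators : (B₁ (ηF Y) ∘ δ) ∘ f ≈ B₁ (F⋆₁ f ∘ ηF X) ∘ β
    generators = begin
      (B₁ (ηF Y) ∘ δ) ∘ f          ≈⟨ assoc ⟩
      B₁ (ηF Y) ∘ (δ ∘ f)          ≈⟨ refl⟩∘⟨ f-hom ⟩
      B₁ (ηF Y) ∘ (B₁ f ∘ β)       ≈⟨ sym-assoc ⟩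
      (B₁ (ηF Y) ∘ B₁ f) ∘ β       ≈⟨ B-homomorphism ⟩∘⟨refl ⟨
      B₁ (ηF Y ∘ f) ∘ β            ≈⟨ B-resp-≈ (F⋆₁∘η f) ⟩∘⟨refl ⟨
      B₁ (F⋆₁ f ∘ ηF X) ∘ β        ∎

  eval-isCoalgebraMorphism : ∀ {A δ} → IsBialgebra A δ → NaturalWrt ρ (eval A) →
                             IsCoalgebraMorphism 𝒞 B (lift δ) δ (eval A)
  eval-isCoalgebraMorphism {A} {δ} bialgebra eval-natural = begin
    δ ∘ eval A                        ≈⟨ project₂ ⟩∘⟨refl ⟨
    (π₂ ∘ ⟨ id , δ ⟩) ∘ eval A        ≈⟨ assoc ⟩
    π₂ ∘ (⟨ id , δ ⟩ ∘ eval A)        ≈⟨ π₂∘≈B₁∘lift (eval-isAlgebraMorphism A) eval-natural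
      (∘-isAlgebraMorphism {freeAlg (Carrier A)} {A} {pairAlgebra A}
        (eval-isAlgebraMorphism A) (⟨id,δ⟩-isAlgebraMorphism bialgebra))
      generators ⟩
    B₁ (eval A) ∘ lift δ              ∎
    where
    η = ηF (Carrier A)
    generators : (⟨ id , δ ⟩ ∘ eval A) ∘ η ≈ ⟨ eval A ∘ η , B₁ (eval A ∘ η) ∘ δ ⟩
    generators = begin
      (⟨ id , δ ⟩ ∘ eval A) ∘ η               ≈⟨ assoc ⟩
      ⟨ id , δ ⟩ ∘ (eval A ∘ η)               ≈⟨ refl⟩∘⟨ eval∘η A ⟩
      ⟨ id , δ ⟩ ∘ id                         ≈⟨ identityʳ ⟩
      ⟨ id , δ ⟩                              ≈⟨ ⟨⟩-cong (eval∘η A) δ≈ ⟨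
      ⟨ eval A ∘ η , B₁ (eval A ∘ η) ∘ δ ⟩    ∎
      where
      δ≈ : B₁ (eval A ∘ η) ∘ δ ≈ δ
      δ≈ = ≈-trans (≈-trans (B-resp-≈ (eval∘η A)) B-identity ⟩∘⟨refl) identityˡ

theorem12 : {o ℓ e : Level} (𝒞 : Category o ℓ e) (P : BinaryProducts 𝒞)
    (Sig : Endofunctor 𝒞) (I : InitialAlgebra 𝒞 Sig) (free : FreeAlgebras 𝒞 Sig)
    (B : Endofunctor 𝒞) (F : FinalCoalgebra 𝒞 B)
    (ρ : GSOS.PreGSOSLaw 𝒞 P Sig B free)
    (γ : Category.Hom 𝒞 (InitialAlgebra.μ I) (Endofunctor.F₀ B (InitialAlgebra.μ I))) →
    GSOS.IsOperationalModel 𝒞 P Sig B free I ρ γ →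
    GSOS.NaturalWrt 𝒞 P Sig B free ρ (GSOS.ι̂ 𝒞 P Sig B free I) →
    GSOS.NaturalWrt 𝒞 P Sig B free ρ (GSOS.F⋆₁ 𝒞 P Sig B free (FinalCoalgebra.unfold F γ)) →
    IsMorphicCongruence 𝒞 Sig (alg (InitialAlgebra.μ I) (InitialAlgebra.ι I)) (FinalCoalgebra.unfold F γ)
theorem12 𝒞 P Sig I free B F ρ γ operational-model ι̂-natural F⋆beh-natural =
  factorisation⇒isMorphicCongruence (alg μ ι) (unfold γ) (unfold (lift τ))
    (unfold-unique₂ F (lift γ)
      (∘-isCoalgebraMorphism (eval-isCoalgebraMorphism operational-model ι̂-natural)
                             (unfold-hom γ))
      (∘-isCoalgebraMorphism (F⋆₁-isCoalgebraMorphism (unfold-hom γ) F⋆beh-natural)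
                             (unfold-hom (lift τ))))
  where
  open InitialAlgebra I
  open FinalCoalgebra F
  open FreeAlgebraLemmas Sig free using (factorisation⇒isMorphicCongruence)
  open FunctorLemmas B using (∘-isCoalgebraMorphism; unfold-unique₂)
  open LiftedCoalgebras P Sig B free ρ
    using (lift; eval-isCoalgebraMorphism; F⋆₁-isCoalgebraMorphism)
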